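{- Let $n\ge 2$ and $d\ge 0$ be integers and let $M$ be a $0,1$ matrix of size $n \times n$ with at most $d$ zeros in each column. Then $\mathrm{rank}_{\mathbb{B}}(M) \leq c(d) \log_2 n$, where $c(d) = 3e(d+1)/\log_2 e$.
   Context: The Boolean rank $\mathrm{rank}_{\mathbb{B}}(M)$ of a $0,1$ matrix $M$ of size $n\times m$ is the minimal $r$ such that $M=A\cdot B$ for $0,1$ matrices $A$ ($n\times r$) and $B$ ($r\times m$) with Boolean arithmetic ($1+1=1$); equivalently, the minimum number of all-ones submatrices (rows and columns not necessarily consecutive) whose union covers all $1$-entries of $M$. -}

module Defs where

open import Data.Bool using (Bool; true; false; _∧_; _∨_)
open import Data.Nat using (ℕ; zero; suc; _+_; _*_; _∸_; _≤_; _!)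

open import Data.Nat.Properties using (_!≢0)
open import Data.Fin using (Fin; zero; suc)
open import Data.Integer using (+_)
open import Data.Rational using (ℚ; _/_; 0ℚ; 1ℚ)
import Data.Rational as Q
open import Data.Product using (Σ; _×_)
open import Relation.Binary.PropositionalEquality using (_≡_)

-- 0,1 matrices of size n × m, entries in Bool (true = 1, false = 0)
Matrix : ℕ → ℕ → Set
Matrix n m = Fin n → Fin m → Bool

anyFin : (r : ℕ) → (Fin r → Bool) → Bool
anyFin zero    f = false
anyFin (suc r) f = f zero ∨ anyFin r (λ k → f (suc k))

_⊙_ : {n r m : ℕ} → Matrix n r → Matrix r m → Matrix n m
_⊙_ {r = r} A B i j = anyFin r (λ k → A i k ∧ B k j)

countZeros : (n : ℕ) → (Fin n → Bool) → ℕ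
countZeros zero    f = 0
countZeros (suc n) f with f zero
... | true  = countZeros n (λ k → f (suc k))
... | false = suc (countZeros n (λ k → f (suc k)))

zerosInColumn : {n m : ℕ} → Matrix n m → Fin m → ℕ
zerosInColumn {n} M j = countZeros n (λ i → M i j)

BoolFactorization : {n m : ℕ} → Matrix n m → ℕ → Set
BoolFactorization {n} {m} M r =
  Σ (Matrix n r) λ A → Σ (Matrix r m) λ B → ∀ i j → M i j ≡ (A ⊙ B) i j

-- rank_B(M) ≤ k  ⇔  M has a Boolean factorization of inner dimension r ≤ k
-- Rational approximations of the real constants

powℚ : ℚ → ℕ → ℚ
powℚ q zero    = 1ℚ
powℚ q (suc k) = q Q.* powℚ q k

-- partial sums of e = Σ_{k ≥ 0} 1/k!   (increasing, converging to e)
eLower : ℕ → ℚ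
eLower zero    = 1ℚ
eLower (suc N) = eLower N Q.+ ((+ 1) / (suc N !)) {{(suc N) !≢0}}

-- partial sums of ln n = 2 Σ_{k ≥ 0} t^(2k+1)/(2k+1),  t = (n-1)/(n+1)
-- (valid for n ≥ 1; all terms ≥ 0, so these increase and converge to ln n)
lnLower : ℕ → ℕ → ℚ
lnLower n zero    = 0ℚ
lnLower n (suc N) = lnLower n N Q.+
  (+ 2 / 1) Q.* powℚ ((+ (n ∸ 1)) / suc n) (suc (2 * N)) Q.* ((+ 1) / suc (2 * N))

-- "(x : ℕ) ≤ 3·e·(d+1)·ln n"  (= c(d) log₂ n with c(d) = 3e(d+1)/log₂ e),
-- expressed via the increasing rational approximations of e and ln n:
-- x ≤ sup_N (3(d+1)·eLower N·lnLower n N)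
LeCBound : ℕ → ℕ → ℕ → Set
LeCBound d n x = ∀ (ε : ℚ) → 0ℚ Q.< ε → Σ ℕ λ N →
  (+ x / 1) Q.< ((+ (3 * (d + 1))) / 1) Q.* eLower N Q.* lnLower n N Q.+ ε

module Submission where

-- Colour the rows with c = 2d + 1 colours. For each colour class, its rows together with the
-- columns having no zero in that class form an all-ones rectangle, so these c rectangles give
-- a factorization of inner dimension c. A 1-entry (i, j) is missed only when one of the at most
-- d zeros of column j gets the colour of row i; for a uniformly random colouring this has
-- probability at most d / c < 1/2, so some colouring covers at least half of the 1-entries still
-- uncovered. After k rounds with n² < 2^k everything is covered, whence
-- rank_B(M) ≤ k(2d + 1) ≤ 2k(d + 1) with 2k ≈ 4 log₂ n < 3e ln n.
-- For the comparison with the rational approximations of e and ln n: e is at least its partial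
-- sum 65/24, and by Bernoulli's inequality every term 2t^m/m (t = (n-1)/(n+1)) of the series of
-- ln n is at least 2/m - 4/(n+1), so that lnLower n N ≥ 2(1 + 1/3 + ... + 1/(2N-1)) - 4N/(n+1);
-- this odd harmonic sum gains at least 1/3 whenever N doubles. The cases n < 32 are checked by
-- computation, using the trivial factorization M = I ⊙ M whenever it is better.

open import Defs

module Approximations where

  open import Data.Nat as ℕ using (ℕ; zero; suc; _∸_; _!)
  import Data.Nat.Properties as ℕ
  open import Data.Nat.Tactic.RingSolver using (solve-∀)
  open import Data.Integer as ℤ using (+_)
  import Data.Integer.Properties as ℤ
  open import Data.Rational as ℚ using (toℚᵘ)
  import Data.Rational.Properties as ℚ
  open import Data.Rational.Unnormalised
  open import Data.Rational.Unnormalised.Properties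
  open import Data.Rational.Unnormalised.Solver using (module +-*-Solver)
  open +-*-Solver
  open import Data.Product using (_,_)
  open import Data.Sum using (_⊎_)
  open import Relation.Binary.PropositionalEquality using (_≡_; refl; cong; cong₂; sym; trans; subst)
  open import Relation.Nullary.Decidable using (toWitness; _→-dec_; _⊎-dec_)

  ι : ℕ → ℚᵘ
  ι a = + a / 1

  ι-+ : ∀ a b → ι (a ℕ.+ b) ≃ ι a + ι b
  ι-+ a b = *≡* (cong (ℤ._* + 1) (trans (ℤ.pos-+ a b)
    (sym (cong₂ ℤ._+_ (ℤ.*-identityʳ (+ a)) (ℤ.*-identityʳ (+ b))))))

  ι-* : ∀ a b → ι (a ℕ.* b) ≃ ι a * ι b
  ι-* a b = *≡* (cong (ℤ._* + 1) (ℤ.pos-* a b))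

  ι-mono-≤ : ∀ {a b} → a ℕ.≤ b → ι a ≤ ι b
  ι-mono-≤ a≤b = *≤* (ℤ.*-monoʳ-≤-nonNeg (+ 1) (ℤ.+≤+ a≤b))

  _^_ : ℚᵘ → ℕ → ℚᵘ
  p ^ zero  = 1ℚᵘ
  p ^ suc k = p * p ^ k

  ^-cong : ∀ {p q} k → p ≃ q → p ^ k ≃ q ^ k
  ^-cong zero    p≃q = ≃-refl
  ^-cong (suc k) p≃q = *-cong p≃q (^-cong k p≃q)

  toℚᵘ-powℚ : ∀ q k → toℚᵘ (powℚ q k) ≃ toℚᵘ q ^ k
  toℚᵘ-powℚ q zero    = ≃-refl
  toℚᵘ-powℚ q (suc k) = ≃-trans (ℚ.toℚᵘ-homo-* q (powℚ q k)) (*-congˡ {toℚᵘ q} (toℚᵘ-powℚ q k))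

  toℚᵘ-/ : ∀ i k → toℚᵘ (i ℚ./ suc k) ≃ mkℚᵘ i k
  toℚᵘ-/ i k = ℚ.toℚᵘ-fromℚᵘ (mkℚᵘ i k)

  bernoulli : ∀ {x} → 0ℚᵘ ≤ x → x ≤ 1ℚᵘ → ∀ m → 1ℚᵘ ≤ (1ℚᵘ - x) ^ m + ι m * x
  bernoulli {x} 0≤x x≤1 zero    = ≤-reflexive (solve 1 (λ x → con 1ℚᵘ := con 1ℚᵘ :+ con 0ℚᵘ :* x) ≃-refl x)
  bernoulli {x} 0≤x x≤1 (suc m) = begin
    1ℚᵘ                                         ≃⟨ solve 1 (λ x → con 1ℚᵘ := (con 1ℚᵘ :- x) :* con 1ℚᵘ :+ x) ≃-refl x ⟩
    y * 1ℚᵘ + x                                 ≤⟨ +-mono-≤ (*-monoʳ-≤-nonNeg y (bernoulli 0≤x x≤1 m))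
                                                             (p≤q+p x (ι m * x * x)) ⟩
    y * (y ^ m + ι m * x) + (ι m * x * x + x)
      ≃⟨ solve 3 (λ x P I → (con 1ℚᵘ :- x) :* (P :+ I :* x) :+ (I :* x :* x :+ x)
                          := (con 1ℚᵘ :- x) :* P :+ (con 1ℚᵘ :+ I) :* x) ≃-refl x (y ^ m) (ι m) ⟩
    y ^ suc m + (1ℚᵘ + ι m) * x                 ≃⟨ +-congʳ (y ^ suc m) (*-congʳ {x} (≃-sym (ι-+ 1 m))) ⟩
    y ^ suc m + ι (suc m) * x                   ∎
    where
    open ≤-Reasoning
    y = 1ℚᵘ - x
    instance
      x≥0 : NonNegative x
      x≥0 = nonNegative 0≤x
      y≥0 : NonNegative y
      y≥0 = nonNegative (p≤q⇒0≤q-p x≤1)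
      mxx≥0 : NonNegative (ι m * x * x)
      mxx≥0 = nonNeg*nonNeg⇒nonNeg (ι m * x) {{nonNeg*nonNeg⇒nonNeg (ι m) x}} x

  1/ι-≤-+ : ∀ p q r → suc p ℕ.* suc q ℕ.≤ (suc q ℕ.+ suc p) ℕ.* suc r →
            1/ ι (suc r) ≤ 1/ ι (suc p) + 1/ ι (suc q)
  1/ι-≤-+ p q r pq≤[q+p]r = *≤* (begin
    + 1 ℤ.* + (suc p ℕ.* suc q)                        ≡⟨ ℤ.*-identityˡ _ ⟩
    + (suc p ℕ.* suc q)                                ≤⟨ ℤ.+≤+ pq≤[q+p]r ⟩
    + ((suc q ℕ.+ suc p) ℕ.* suc r)                    ≡⟨ ℤ.pos-* (suc q ℕ.+ suc p) (suc r) ⟩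
    + (suc q ℕ.+ suc p) ℤ.* + suc r                    ≡⟨ cong (ℤ._* + suc r) (ℤ.pos-+ (suc q) (suc p)) ⟩
    (+ suc q ℤ.+ + suc p) ℤ.* + suc r                  ≡⟨ cong₂ (λ a b → (a ℤ.+ b) ℤ.* + suc r)
                                                                (ℤ.*-identityˡ (+ suc q)) (ℤ.*-identityˡ (+ suc p)) ⟨
    (+ 1 ℤ.* + suc q ℤ.+ + 1 ℤ.* + suc p) ℤ.* + suc r  ∎)
    where open ℤ.≤-Reasoning

  1/[2M+1]≤1/[4M+1]+1/[4M+3] : ∀ M →
    1/ ι (suc (2 ℕ.* M)) ≤ 1/ ι (suc (2 ℕ.* (2 ℕ.* M))) + 1/ ι (suc (2 ℕ.* suc (2 ℕ.* M)))
  1/[2M+1]≤1/[4M+1]+1/[4M+3] M = 1/ι-≤-+ (2 ℕ.* (2 ℕ.* M)) (2 ℕ.* suc (2 ℕ.* M)) (2 ℕ.* M)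
    (ℕ.≤-trans (ℕ.m≤m+n _ 1) (ℕ.≤-reflexive (identity M)))
    where
    identity : ∀ M → suc (2 ℕ.* (2 ℕ.* M)) ℕ.* suc (2 ℕ.* suc (2 ℕ.* M)) ℕ.+ 1
                   ≡ (suc (2 ℕ.* suc (2 ℕ.* M)) ℕ.+ suc (2 ℕ.* (2 ℕ.* M))) ℕ.* suc (2 ℕ.* M)
    identity = solve-∀

  oddHarmonic : ℕ → ℚᵘ
  oddHarmonic zero    = 0ℚᵘ
  oddHarmonic (suc N) = oddHarmonic N + 1/ ι (suc (2 ℕ.* N))

  -- The gain oddHarmonic (2 * M) - oddHarmonic M does not decrease with M and is 1/3 at M = 1.
  oddHarmonic-double : ∀ M → oddHarmonic (suc M) + + 1 / 3 ≤ oddHarmonic (2 ℕ.* suc M)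
  oddHarmonic-double zero    = ≤ᵇ⇒≤ _
  oddHarmonic-double (suc M) = begin
    H (suc M) + 1/ ι (suc (2 ℕ.* K)) + ⅓     ≃⟨ solve 3 (λ a b c → a :+ b :+ c := a :+ c :+ b) ≃-refl (H (suc M)) _ ⅓ ⟩
    H (suc M) + ⅓ + 1/ ι (suc (2 ℕ.* K))     ≤⟨ +-mono-≤ (oddHarmonic-double M) (1/[2M+1]≤1/[4M+1]+1/[4M+3] K) ⟩
    H (2 ℕ.* K) + (1/ ι (suc (2 ℕ.* (2 ℕ.* K))) + 1/ ι (suc (2 ℕ.* suc (2 ℕ.* K))))
                                             ≃⟨ +-assoc (H (2 ℕ.* K)) _ _ ⟨
    H (suc (suc (2 ℕ.* K)))                  ≡⟨ cong H (ℕ.*-suc 2 K) ⟨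
    H (2 ℕ.* suc K)                          ∎
    where
    open ≤-Reasoning
    H = oddHarmonic
    K = suc M
    ⅓ = + 1 / 3

  oddHarmonic-2^ : ∀ c → 1ℚᵘ + ι c * (+ 1 / 3) ≤ oddHarmonic (2 ℕ.^ c)
  oddHarmonic-2^ zero    = ≤ᵇ⇒≤ _
  oddHarmonic-2^ (suc c) = begin
    1ℚᵘ + ι (suc c) * ⅓                  ≃⟨ +-congʳ 1ℚᵘ (*-congʳ {⅓} (ι-+ 1 c)) ⟩
    1ℚᵘ + (1ℚᵘ + ι c) * ⅓                ≃⟨ solve 2 (λ i t → con 1ℚᵘ :+ (con 1ℚᵘ :+ i) :* t := con 1ℚᵘ :+ i :* t :+ t)
                                                    ≃-refl (ι c) ⅓ ⟩
    1ℚᵘ + ι c * ⅓ + ⅓                    ≤⟨ +-monoˡ-≤ ⅓ (oddHarmonic-2^ c) ⟩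
    oddHarmonic N + ⅓                    ≡⟨ cong (λ K → oddHarmonic K + ⅓) (ℕ.suc-pred N) ⟨
    oddHarmonic (suc (ℕ.pred N)) + ⅓     ≤⟨ oddHarmonic-double (ℕ.pred N) ⟩
    oddHarmonic (2 ℕ.* suc (ℕ.pred N))   ≡⟨ cong (λ K → oddHarmonic (2 ℕ.* K)) (ℕ.suc-pred N) ⟩
    oddHarmonic (2 ℕ.* N)                ∎
    where
    open ≤-Reasoning
    ⅓ = + 1 / 3
    N = 2 ℕ.^ c
    instance
      N≢0 : ℕ.NonZero N
      N≢0 = ℕ.m^n≢0 2 c

  eLowerᵘ : ℕ → ℚᵘ
  eLowerᵘ N = toℚᵘ (eLower N)

  lnLowerᵘ : ℕ → ℕ → ℚᵘ
  lnLowerᵘ n N = toℚᵘ (lnLower n N)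

  eLowerᵘ-≤-suc : ∀ N → eLowerᵘ N ≤ eLowerᵘ (suc N)
  eLowerᵘ-≤-suc N = ≤-respʳ-≃ (≃-sym (ℚ.toℚᵘ-homo-+ (eLower N) term))
                              (p≤p+q (eLowerᵘ N) (toℚᵘ term) {{ℚ.normalize-nonNeg 1 (suc N !) {{suc N ℕ.!≢0}}}})
    where
    term = (+ 1 ℚ./ (suc N !)) {{suc N ℕ.!≢0}}

  65/24≤eLowerᵘ : ∀ K → + 65 / 24 ≤ eLowerᵘ (4 ℕ.+ K)
  65/24≤eLowerᵘ zero    = ≤ᵇ⇒≤ _
  65/24≤eLowerᵘ (suc K) = ≤-trans (65/24≤eLowerᵘ K) (eLowerᵘ-≤-suc (4 ℕ.+ K))

  -- mkℚᵘ (+ (n ∸ 1)) n is t = (n - 1) / (n + 1): mkℚᵘ stores the denominator minus one.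
  lnLowerᵘ-suc : ∀ n N → let m = suc (2 ℕ.* N) in
    lnLowerᵘ n (suc N) ≃ lnLowerᵘ n N + ι 2 * mkℚᵘ (+ (n ∸ 1)) n ^ m * 1/ ι m
  lnLowerᵘ-suc n N = begin-equality
    toℚᵘ (lnLower n N ℚ.+ two ℚ.* powℚ t m ℚ.* 1/m)
      ≃⟨ ℚ.toℚᵘ-homo-+ (lnLower n N) _ ⟩
    lnLowerᵘ n N + toℚᵘ (two ℚ.* powℚ t m ℚ.* 1/m)
      ≃⟨ +-congʳ (lnLowerᵘ n N) (≃-trans (ℚ.toℚᵘ-homo-* (two ℚ.* powℚ t m) 1/m)
                                          (*-congʳ {toℚᵘ 1/m} (ℚ.toℚᵘ-homo-* two (powℚ t m)))) ⟩
    lnLowerᵘ n N + toℚᵘ two * toℚᵘ (powℚ t m) * toℚᵘ 1/m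
      ≃⟨ +-congʳ (lnLowerᵘ n N) (*-cong (*-cong (toℚᵘ-/ (+ 2) 0) (≃-trans (toℚᵘ-powℚ t m) (^-cong m (toℚᵘ-/ _ n))))
                                         (toℚᵘ-/ (+ 1) (2 ℕ.* N))) ⟩
    lnLowerᵘ n N + ι 2 * mkℚᵘ (+ (n ∸ 1)) n ^ m * 1/ ι m
      ∎
    where
    open ≤-Reasoning
    m = suc (2 ℕ.* N)
    two = + 2 ℚ./ 1
    t = + (n ∸ 1) ℚ./ suc n
    1/m = + 1 ℚ./ m

  n/[n+2]≃1-2/[n+2] : ∀ n → mkℚᵘ (+ n) (suc n) ≃ 1ℚᵘ - + 2 / suc (suc n)
  n/[n+2]≃1-2/[n+2] n =
    *≡* (subst (λ k → + n ℤ.* + suc (suc k) ≡ + k ℤ.* + suc (suc n)) (sym (ℕ.+-identityʳ n)) refl)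

  ι*2/[1+k]≤1 : ∀ a k → a ℕ.* 2 ℕ.≤ suc k → ι a * (+ 2 / suc k) ≤ 1ℚᵘ
  ι*2/[1+k]≤1 a k 2a≤1+k = *≤* (begin
    + a ℤ.* + 2 ℤ.* + 1         ≡⟨ ℤ.*-identityʳ _ ⟩
    + a ℤ.* + 2                 ≡⟨ ℤ.pos-* a 2 ⟨
    + (a ℕ.* 2)                 ≤⟨ ℤ.+≤+ 2a≤1+k ⟩
    + suc k                     ≡⟨ cong (λ j → + suc j) (ℕ.+-identityʳ k) ⟨
    + suc (k ℕ.+ 0)             ≡⟨ ℤ.*-identityˡ _ ⟨
    + 1 ℤ.* + suc (k ℕ.+ 0)     ∎)
    where open ℤ.≤-Reasoning

  lnTerm-≥ : ∀ n m → let x = + 2 / suc (suc n) ; u = 1/ ι (suc m) in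
    ι 2 * u ≤ ι 2 * mkℚᵘ (+ n) (suc n) ^ suc m * u + ι 2 * x
  lnTerm-≥ n m = begin
    ι 2 * u                                         ≃⟨ *-identityʳ (ι 2 * u) ⟨
    ι 2 * u * 1ℚᵘ                                   ≤⟨ *-monoʳ-≤-nonNeg (ι 2 * u) {{nonNeg*nonNeg⇒nonNeg (ι 2) u}}
                                                                        (bernoulli (nonNegative⁻¹ x) x≤1 (suc m)) ⟩
    ι 2 * u * ((1ℚᵘ - x) ^ suc m + ι (suc m) * x)
      ≃⟨ solve 4 (λ u x p i → con (ι 2) :* u :* (p :+ i :* x) := con (ι 2) :* p :* u :+ con (ι 2) :* (i :* u) :* x)
                 ≃-refl u x ((1ℚᵘ - x) ^ suc m) (ι (suc m)) ⟩
    ι 2 * (1ℚᵘ - x) ^ suc m * u + ι 2 * (ι (suc m) * u) * x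
      ≃⟨ +-cong (*-congʳ {u} (*-congˡ {ι 2} (^-cong (suc m) (≃-sym (n/[n+2]≃1-2/[n+2] n)))))
                (*-congʳ {x} (*-congˡ {ι 2} (*-inverseʳ (ι (suc m))))) ⟩
    ι 2 * mkℚᵘ (+ n) (suc n) ^ suc m * u + ι 2 * 1ℚᵘ * x
      ≃⟨ +-congʳ (ι 2 * mkℚᵘ (+ n) (suc n) ^ suc m * u) (*-congʳ {x} (*-identityʳ (ι 2))) ⟩
    ι 2 * mkℚᵘ (+ n) (suc n) ^ suc m * u + ι 2 * x  ∎
    where
    open ≤-Reasoning
    x = + 2 / suc (suc n)
    u = 1/ ι (suc m)
    x≤1 : x ≤ 1ℚᵘ
    x≤1 = ≤-respˡ-≃ (*-identityˡ x) (ι*2/[1+k]≤1 1 (suc n) (ℕ.s≤s (ℕ.s≤s ℕ.z≤n)))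

  2*oddHarmonic≤lnLowerᵘ : ∀ n N →
    ι 2 * oddHarmonic N ≤ lnLowerᵘ (suc n) N + ι (2 ℕ.* N) * (+ 2 / suc (suc n))
  2*oddHarmonic≤lnLowerᵘ n zero    =
    ≤-reflexive (solve 1 (λ x → con (ι 2) :* con 0ℚᵘ := con 0ℚᵘ :+ con 0ℚᵘ :* x) ≃-refl (+ 2 / suc (suc n)))
  2*oddHarmonic≤lnLowerᵘ n (suc N) = begin
    ι 2 * (oddHarmonic N + u)                        ≃⟨ *-distribˡ-+ (ι 2) (oddHarmonic N) u ⟩
    ι 2 * oddHarmonic N + ι 2 * u                    ≤⟨ +-mono-≤ (2*oddHarmonic≤lnLowerᵘ n N) (lnTerm-≥ n (2 ℕ.* N)) ⟩
    lnLowerᵘ (suc n) N + ι (2 ℕ.* N) * x + (term + ι 2 * x)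
      ≃⟨ solve 4 (λ l a x s → l :+ a :* x :+ (s :+ con (ι 2) :* x) := l :+ s :+ (con (ι 2) :+ a) :* x)
                 ≃-refl (lnLowerᵘ (suc n) N) (ι (2 ℕ.* N)) x term ⟩
    lnLowerᵘ (suc n) N + term + (ι 2 + ι (2 ℕ.* N)) * x
      ≃⟨ +-cong (≃-sym (lnLowerᵘ-suc (suc n) N)) (*-congʳ {x} (≃-sym (ι-+ 2 (2 ℕ.* N)))) ⟩
    lnLowerᵘ (suc n) (suc N) + ι (2 ℕ.+ 2 ℕ.* N) * x
      ≡⟨ cong (λ k → lnLowerᵘ (suc n) (suc N) + ι k * x) (ℕ.*-suc 2 N) ⟨
    lnLowerᵘ (suc n) (suc N) + ι (2 ℕ.* suc N) * x   ∎
    where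
    open ≤-Reasoning
    x = + 2 / suc (suc n)
    u = 1/ ι (suc (2 ℕ.* N))
    term = ι 2 * mkℚᵘ (+ n) (suc n) ^ suc (2 ℕ.* N) * u

  1+2c/3≤lnLowerᵘ : ∀ c n → 2 ℕ.^ (2 ℕ.+ c) ℕ.≤ suc n → 1ℚᵘ + ι c * (+ 2 / 3) ≤ lnLowerᵘ (suc n) (2 ℕ.^ c)
  1+2c/3≤lnLowerᵘ c n 4N≤1+n = begin
    1ℚᵘ + ι c * ⅔                    ≃⟨ solve 1 (λ i → con 1ℚᵘ :+ i :* con ⅔
                                                  := con (ι 2) :* (con 1ℚᵘ :+ i :* con ⅓) :- con 1ℚᵘ) ≃-refl (ι c) ⟩
    ι 2 * (1ℚᵘ + ι c * ⅓) - 1ℚᵘ      ≤⟨ +-monoˡ-≤ (- 1ℚᵘ) 2[1+c/3]≤L+1 ⟩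
    lnLowerᵘ (suc n) N + 1ℚᵘ - 1ℚᵘ   ≃⟨ solve 1 (λ l → l :+ con 1ℚᵘ :- con 1ℚᵘ := l) ≃-refl (lnLowerᵘ (suc n) N) ⟩
    lnLowerᵘ (suc n) N               ∎
    where
    open ≤-Reasoning
    ⅓ = + 1 / 3
    ⅔ = + 2 / 3
    N = 2 ℕ.^ c
    2N*2≤2+n : 2 ℕ.* N ℕ.* 2 ℕ.≤ suc (suc n)
    2N*2≤2+n = ℕ.≤-trans (ℕ.≤-reflexive (ℕ.*-comm (2 ℕ.* N) 2)) (ℕ.≤-trans 4N≤1+n (ℕ.n≤1+n (suc n)))
    2[1+c/3]≤L+1 : ι 2 * (1ℚᵘ + ι c * ⅓) ≤ lnLowerᵘ (suc n) N + 1ℚᵘ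
    2[1+c/3]≤L+1 = begin
      ι 2 * (1ℚᵘ + ι c * ⅓)                                   ≤⟨ *-monoʳ-≤-nonNeg (ι 2) (oddHarmonic-2^ c) ⟩
      ι 2 * oddHarmonic N                                     ≤⟨ 2*oddHarmonic≤lnLowerᵘ n N ⟩
      lnLowerᵘ (suc n) N + ι (2 ℕ.* N) * (+ 2 / suc (suc n))  ≤⟨ +-monoʳ-≤ (lnLowerᵘ (suc n) N)
                                                                            (ι*2/[1+k]≤1 (2 ℕ.* N) (suc n) 2N*2≤2+n) ⟩
      lnLowerᵘ (suc n) N + 1ℚᵘ                                ∎

  infix 4 _≤3·e·ln[_,_]
  _≤3·e·ln[_,_] : ℕ → ℕ → ℕ → Set
  q ≤3·e·ln[ n , N ] = ι q ≤ ι 3 * eLowerᵘ N * lnLowerᵘ n N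

  4[6+b]≤3·e·ln : ∀ b n → 2 ℕ.^ (5 ℕ.+ b) ℕ.≤ suc n → 4 ℕ.* (6 ℕ.+ b) ≤3·e·ln[ suc n , 2 ℕ.^ (3 ℕ.+ b) ]
  4[6+b]≤3·e·ln b n 2^[5+b]≤1+n = begin
    ι (4 ℕ.* (6 ℕ.+ b))                       ≡⟨ cong ι (ℕ.*-distribˡ-+ 4 6 b) ⟩
    ι (24 ℕ.+ 4 ℕ.* b)                        ≃⟨ ≃-trans (ι-+ 24 (4 ℕ.* b)) (+-congʳ (ι 24) (ι-* 4 b)) ⟩
    ι 24 + ι 4 * ι b                          ≤⟨ +-mono-≤ 24≤ (*-monoˡ-≤-nonNeg (ι b) 4≤) ⟩
    ι 3 * e₀ * (1ℚᵘ + ι 3 * ⅔) + ι 3 * e₀ * ⅔ * ι b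
      ≃⟨ solve 4 (λ three e t β → three :* e :* (con 1ℚᵘ :+ three :* t) :+ three :* e :* t :* β
                                := three :* e :* (con 1ℚᵘ :+ (three :+ β) :* t)) ≃-refl (ι 3) e₀ ⅔ (ι b) ⟩
    ι 3 * e₀ * (1ℚᵘ + (ι 3 + ι b) * ⅔)        ≃⟨ *-congˡ {ι 3 * e₀} (+-congʳ 1ℚᵘ (*-congʳ {⅔} (ι-+ 3 b))) ⟨
    ι 3 * e₀ * X                              ≤⟨ *-monoˡ-≤-nonNeg X (*-monoʳ-≤-nonNeg (ι 3) e₀≤E) ⟩
    ι 3 * E * X                               ≤⟨ *-monoʳ-≤-nonNeg (ι 3 * E) (1+2c/3≤lnLowerᵘ (3 ℕ.+ b) n 2^[5+b]≤1+n) ⟩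
    ι 3 * E * lnLowerᵘ (suc n) N              ∎
    where
    open ≤-Reasoning
    ⅔ = + 2 / 3
    e₀ = + 65 / 24
    N = 2 ℕ.^ (3 ℕ.+ b)
    E = eLowerᵘ N
    X = 1ℚᵘ + ι (3 ℕ.+ b) * ⅔
    24≤ : ι 24 ≤ ι 3 * e₀ * (1ℚᵘ + ι 3 * ⅔)
    24≤ = ≤ᵇ⇒≤ _
    4≤ : ι 4 ≤ ι 3 * e₀ * ⅔
    4≤ = ≤ᵇ⇒≤ _
    e₀≤E : e₀ ≤ E
    e₀≤E = subst (λ K → e₀ ≤ eLowerᵘ K) (ℕ.m+[n∸m]≡n 4≤N) (65/24≤eLowerᵘ (N ∸ 4))
      where
      4≤N : 4 ℕ.≤ N
      4≤N = ℕ.^-monoʳ-≤ 2 {2} {3 ℕ.+ b} (ℕ.s≤s (ℕ.s≤s ℕ.z≤n))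
    instance
      X≥0 : NonNegative X
      X≥0 = nonNeg+nonNeg⇒nonNeg 1ℚᵘ (ι (3 ℕ.+ b) * ⅔) {{nonNeg*nonNeg⇒nonNeg (ι (3 ℕ.+ b)) ⅔}}
      ι3*E≥0 : NonNegative (ι 3 * E)
      ι3*E≥0 = nonNeg*nonNeg⇒nonNeg (ι 3) E {{nonNegative (≤-trans (≤ᵇ⇒≤ _) e₀≤E)}}

  -- 20 = 2 · 10, and 10 rounds of covering suffice for n ≤ 31 since 31² < 2¹⁰.
  -- The first alternative holds for n ≤ 20, the second for 21 ≤ n ≤ 31.
  small≤3·e·ln : ∀ {n} → n ℕ.< 32 → 2 ℕ.≤ n → n ≤3·e·ln[ n , 3 ] ⊎ 20 ≤3·e·ln[ n , 3 ]
  small≤3·e·ln = toWitness {a? = ℕ.allUpTo? (λ n → (2 ℕ.≤? n) →-dec ((ι n ≤? B n) ⊎-dec (ι 20 ≤? B n))) 32} _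
    where
    B : ℕ → ℚᵘ
    B n = ι 3 * eLowerᵘ 3 * lnLowerᵘ n 3

  leCBound-intro : ∀ d n {r} q N → r ℕ.≤ (d ℕ.+ 1) ℕ.* q → q ≤3·e·ln[ n , N ] → LeCBound d n r
  leCBound-intro d n {r} q N r≤[d+1]q q≤3eL ε ε>0 =
    N , ℚ.≤-<-trans (ℚ.toℚᵘ-cancel-≤ r≤bound) (subst (ℚ._< bound ℚ.+ ε) (ℚ.+-identityʳ bound) (ℚ.+-monoʳ-< bound ε>0))
    where
    open ≤-Reasoning
    E = eLowerᵘ N
    L = lnLowerᵘ n N
    bound = (+ (3 ℕ.* (d ℕ.+ 1)) ℚ./ 1) ℚ.* eLower N ℚ.* lnLower n N
    r≤bound : toℚᵘ (+ r ℚ./ 1) ≤ toℚᵘ bound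
    r≤bound = begin
      toℚᵘ (+ r ℚ./ 1)               ≃⟨ toℚᵘ-/ (+ r) 0 ⟩
      ι r                            ≤⟨ ι-mono-≤ r≤[d+1]q ⟩
      ι ((d ℕ.+ 1) ℕ.* q)            ≃⟨ ι-* (d ℕ.+ 1) q ⟩
      ι (d ℕ.+ 1) * ι q              ≤⟨ *-monoʳ-≤-nonNeg (ι (d ℕ.+ 1)) q≤3eL ⟩
      ι (d ℕ.+ 1) * (ι 3 * E * L)    ≃⟨ solve 4 (λ δ three e l → δ :* (three :* e :* l) := three :* δ :* e :* l)
                                                ≃-refl (ι (d ℕ.+ 1)) (ι 3) E L ⟩
      ι 3 * ι (d ℕ.+ 1) * E * L      ≃⟨ *-congʳ {L} (*-congʳ {E} (ι-* 3 (d ℕ.+ 1))) ⟨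
      ι (3 ℕ.* (d ℕ.+ 1)) * E * L    ≃⟨ ≃-trans (ℚ.toℚᵘ-homo-* (+ (3 ℕ.* (d ℕ.+ 1)) ℚ./ 1 ℚ.* eLower N) (lnLower n N))
                                          (*-congʳ {L} (≃-trans (ℚ.toℚᵘ-homo-* (+ (3 ℕ.* (d ℕ.+ 1)) ℚ./ 1) (eLower N))
                                                                (*-congʳ {E} (toℚᵘ-/ (+ (3 ℕ.* (d ℕ.+ 1))) 0)))) ⟨
      toℚᵘ bound                     ∎


open import Data.Bool using (Bool; true; false; _∧_; _∨_; not; T)
open import Data.Bool.Properties using (∨-assoc; ∨-identityʳ; T-≡; T-not-≡; T-∧; T-∨)
open import Data.Empty using (⊥-elim)
open import Data.Fin using (Fin; zero; suc; splitAt)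
open import Data.Fin.Properties using (_≟_)
open import Data.Nat using (ℕ; zero; suc; _+_; _*_; _^_; _∸_; _≤_; _<_; _<?_; z≤n; s≤s; NonZero)
open import Data.Nat.Properties hiding (_≟_)
open import Data.Nat.Tactic.RingSolver using (solve-∀)
open import Algebra.Properties.Semiring.Sum +-*-semiring
  using (sum-syntax; sum-cong-≗; sum-replicate-zero; ∑-comm; *-distribˡ-sum)
open import Data.Product using (Σ; _×_; _,_; proj₁; map)
open import Data.Sum using (_⊎_; inj₁; inj₂; [_,_]′; map₂)
open import Data.Sum.Properties using ([,]-map)
open import Data.Vec.Functional using (Vector; _∷_; _++_)
open import Function using (_∘_; id)
open import Function.Bundles using (Equivalence)
open import Relation.Binary.PropositionalEquality
open import Relation.Nullary using (does; toSum; yes; no)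
open import Relation.Nullary.Decidable using (dec-true)

open Equivalence using (to; from)
open Approximations using (_≤3·e·ln[_,_]; 4[6+b]≤3·e·ln; small≤3·e·ln; leCBound-intro)

⟦_⟧ : Bool → ℕ
⟦ true ⟧  = 1
⟦ false ⟧ = 0

⟦∨⟧≤ : ∀ a b → ⟦ a ∨ b ⟧ ≤ ⟦ a ⟧ + ⟦ b ⟧
⟦∨⟧≤ true  b = s≤s z≤n
⟦∨⟧≤ false b = ≤-refl

⟦⟧≤1 : ∀ a → ⟦ a ⟧ ≤ 1
⟦⟧≤1 true  = ≤-refl
⟦⟧≤1 false = z≤n

T⇒⟦⟧≡1 : ∀ {b} → T b → ⟦ b ⟧ ≡ 1
T⇒⟦⟧≡1 {true} _ = refl

T-ext : ∀ {a b} → (T a → T b) → (T b → T a) → a ≡ b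
T-ext {true}  {true}  _   _   = refl
T-ext {true}  {false} a⇒b _   = ⊥-elim (a⇒b _)
T-ext {false} {true}  _   b⇒a = ⊥-elim (b⇒a _)
T-ext {false} {false} _   _   = refl

T-split : ∀ a b → T a → T (not b) ⊎ T (a ∧ b)
T-split true false _ = inj₁ _
T-split true true  _ = inj₂ _

∑-mono-≤ : ∀ {n} {f g : Fin n → ℕ} → (∀ i → f i ≤ g i) → ∑[ i < n ] f i ≤ ∑[ i < n ] g i
∑-mono-≤ {zero}  f≤g = z≤n
∑-mono-≤ {suc n} f≤g = +-mono-≤ (f≤g zero) (∑-mono-≤ (f≤g ∘ suc))

∑-const : ∀ n k → ∑[ i < n ] k ≡ n * k
∑-const zero    k = refl
∑-const (suc n) k = cong (k +_) (∑-const n k)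

term≤∑ : ∀ {n} (f : Fin n → ℕ) i → f i ≤ ∑[ i < n ] f i
term≤∑ f zero    = m≤m+n (f zero) _
term≤∑ f (suc i) = ≤-trans (term≤∑ (f ∘ suc) i) (m≤n+m _ (f zero))

∑-pigeonhole : ∀ {n} .{{_ : NonZero n}} (f g : Fin n → ℕ) → ∑[ i < n ] f i ≤ ∑[ i < n ] g i →
               Σ (Fin n) λ i → f i ≤ g i
∑-pigeonhole {suc zero}    f g ∑f≤∑g = zero , subst₂ _≤_ (+-identityʳ (f zero)) (+-identityʳ (g zero)) ∑f≤∑g
∑-pigeonhole {suc (suc n)} f g ∑f≤∑g = [ (zero ,_) , (λ f₀≰g₀ → map suc id (∑-pigeonhole (f ∘ suc) (g ∘ suc)
  (+-cancelˡ-≤ (g zero) _ _ (≤-trans (+-monoˡ-≤ _ (<⇒≤ (≰⇒> f₀≰g₀))) ∑f≤∑g)))) ]′ (toSum (f zero ≤? g zero))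

∑-⟦a≟⟧ : ∀ {c} (a : Fin c) → ∑[ b < c ] ⟦ does (a ≟ b) ⟧ ≡ 1
∑-⟦a≟⟧ {suc c} zero    = cong suc (sum-replicate-zero c)
∑-⟦a≟⟧ {suc c} (suc a) = ∑-⟦a≟⟧ a

∑-⟦≟a⟧ : ∀ {c} (a : Fin c) → ∑[ b < c ] ⟦ does (b ≟ a) ⟧ ≡ 1
∑-⟦≟a⟧ {suc c} zero    = cong suc (sum-replicate-zero c)
∑-⟦≟a⟧ {suc c} (suc a) = ∑-⟦≟a⟧ a

anyFin-cong : ∀ {n} {f g : Fin n → Bool} → (∀ i → f i ≡ g i) → anyFin n f ≡ anyFin n g
anyFin-cong {zero}  f≗g = refl
anyFin-cong {suc n} f≗g = cong₂ _∨_ (f≗g zero) (anyFin-cong (f≗g ∘ suc))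

anyFin-false : ∀ n → anyFin n (λ _ → false) ≡ false
anyFin-false zero    = refl
anyFin-false (suc n) = anyFin-false n

anyFin-intro : ∀ {n} (f : Fin n → Bool) i → T (f i) → T (anyFin n f)
anyFin-intro f zero    fᵢ = from T-∨ (inj₁ fᵢ)
anyFin-intro f (suc i) fᵢ = from T-∨ (inj₂ (anyFin-intro (f ∘ suc) i fᵢ))

⟦anyFin⟧≤∑ : ∀ {n} (f : Fin n → Bool) → ⟦ anyFin n f ⟧ ≤ ∑[ i < n ] ⟦ f i ⟧
⟦anyFin⟧≤∑ {zero}  f = z≤n
⟦anyFin⟧≤∑ {suc n} f = ≤-trans (⟦∨⟧≤ (f zero) _) (+-monoʳ-≤ ⟦ f zero ⟧ (⟦anyFin⟧≤∑ (f ∘ suc)))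

anyFin-select : ∀ {c} (a : Fin c) (f : Fin c → Bool) → anyFin c (λ b → does (a ≟ b) ∧ f b) ≡ f a
anyFin-select {suc c} zero    f = trans (cong (f zero ∨_) (anyFin-false c)) (∨-identityʳ (f zero))
anyFin-select {suc c} (suc a) f = anyFin-select a (f ∘ suc)

anyFin-++ : ∀ {r s} (f : Vector Bool r) (g : Vector Bool s) →
            anyFin (r + s) (f ++ g) ≡ anyFin r f ∨ anyFin s g
anyFin-++ {zero}  f g = refl
anyFin-++ {suc r} f g = begin
  f zero ∨ anyFin (r + _) (λ k → (f ++ g) (suc k))  ≡⟨ cong (f zero ∨_) (anyFin-cong (λ k → [,]-map (splitAt r k))) ⟩
  f zero ∨ anyFin (r + _) ((f ∘ suc) ++ g)          ≡⟨ cong (f zero ∨_) (anyFin-++ (f ∘ suc) g) ⟩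
  f zero ∨ (anyFin r (f ∘ suc) ∨ anyFin _ g)        ≡⟨ ∨-assoc (f zero) _ _ ⟨
  anyFin (suc r) f ∨ anyFin _ g                     ∎
  where open ≡-Reasoning

indicator : ∀ {n c} → (Fin n → Fin c) → Matrix n c
indicator h i a = does (h i ≟ a)

⊙-indicator : ∀ {n c m} (h : Fin n → Fin c) (B : Matrix c m) i j → (indicator h ⊙ B) i j ≡ B (h i) j
⊙-indicator h B i j = anyFin-select (h i) (λ a → B a j)

factorization-trivial : ∀ {n m} (M : Matrix n m) → BoolFactorization M n
factorization-trivial M = indicator (λ i → i) , M , λ i j → sym (⊙-indicator (λ i → i) M i j)

∧-++ : ∀ {r s m} (a₁ : Vector Bool r) (a₂ : Vector Bool s) (B₁ : Matrix r m) (B₂ : Matrix s m) j k →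
       (a₁ ++ a₂) k ∧ (B₁ ++ B₂) k j ≡ ((λ k → a₁ k ∧ B₁ k j) ++ (λ k → a₂ k ∧ B₂ k j)) k
∧-++ {r} a₁ a₂ B₁ B₂ j k with splitAt r k
... | inj₁ _ = refl
... | inj₂ _ = refl

⊙-++ : ∀ {n r s m} (A₁ : Matrix n r) (A₂ : Matrix n s) (B₁ : Matrix r m) (B₂ : Matrix s m) i j →
       ((λ i → A₁ i ++ A₂ i) ⊙ (B₁ ++ B₂)) i j ≡ (A₁ ⊙ B₁) i j ∨ (A₂ ⊙ B₂) i j
⊙-++ A₁ A₂ B₁ B₂ i j = trans (anyFin-cong (∧-++ (A₁ i) (A₂ i) B₁ B₂ j))
                              (anyFin-++ (λ k → A₁ i k ∧ B₁ k j) (λ k → A₂ i k ∧ B₂ k j))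

_⊆_ : ∀ {n m} → Matrix n m → Matrix n m → Set
X ⊆ Y = ∀ i j → T (X i j) → T (Y i j)

ones : ∀ {n m} → Matrix n m → ℕ
ones {n} {m} W = ∑[ i < n ] ∑[ j < m ] ⟦ W i j ⟧

ones-pos : ∀ {n m} (W : Matrix n m) i j → T (W i j) → 0 < ones W
ones-pos {n} {m} W i j Wᵢⱼ = begin
  1                       ≡⟨ T⇒⟦⟧≡1 Wᵢⱼ ⟨
  ⟦ W i j ⟧               ≤⟨ term≤∑ (λ j → ⟦ W i j ⟧) j ⟩
  ∑[ j < m ] ⟦ W i j ⟧    ≤⟨ term≤∑ (λ i → ∑[ j < m ] ⟦ W i j ⟧) i ⟩
  ones W                  ∎
  where open ≤-Reasoning

ones≤size : ∀ {n m} (W : Matrix n m) → ones W ≤ n * m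
ones≤size {n} {m} W = begin
  ones W                   ≤⟨ ∑-mono-≤ (λ i → ∑-mono-≤ (λ j → ⟦⟧≤1 (W i j))) ⟩
  ∑[ i < n ] ∑[ j < m ] 1  ≡⟨ sum-cong-≗ {n} (λ i → trans (∑-const m 1) (*-identityʳ m)) ⟩
  ∑[ i < n ] m             ≡⟨ ∑-const n m ⟩
  n * m                    ∎
  where open ≤-Reasoning

countZeros≡∑ : ∀ n (f : Fin n → Bool) → countZeros n f ≡ ∑[ i < n ] ⟦ not (f i) ⟧
countZeros≡∑ zero    f = refl
countZeros≡∑ (suc n) f with f zero
... | true  = countZeros≡∑ n (f ∘ suc)
... | false = cong suc (countZeros≡∑ n (f ∘ suc))

module ColouringSum (c : ℕ) where

  Colouring : ℕ → Set
  Colouring n = Fin n → Fin c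

  ∑ᶜ : ∀ n → (Colouring n → ℕ) → ℕ
  ∑ᶜ zero    F = F (λ ())
  ∑ᶜ (suc n) F = ∑[ a < c ] ∑ᶜ n (λ h → F (a ∷ h))

  ∑ᶜ-mono-≤ : ∀ n {F G : Colouring n → ℕ} → (∀ h → F h ≤ G h) → ∑ᶜ n F ≤ ∑ᶜ n G
  ∑ᶜ-mono-≤ zero    F≤G = F≤G _
  ∑ᶜ-mono-≤ (suc n) F≤G = ∑-mono-≤ (λ a → ∑ᶜ-mono-≤ n (λ h → F≤G (a ∷ h)))

  ∑ᶜ-const : ∀ n k → ∑ᶜ n (λ _ → k) ≡ c ^ n * k
  ∑ᶜ-const zero    k = sym (+-identityʳ k)
  ∑ᶜ-const (suc n) k = begin
    ∑[ a < c ] ∑ᶜ n (λ _ → k)  ≡⟨ sum-cong-≗ {c} (λ _ → ∑ᶜ-const n k) ⟩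
    ∑[ a < c ] (c ^ n * k)     ≡⟨ ∑-const c (c ^ n * k) ⟩
    c * (c ^ n * k)            ≡⟨ *-assoc c (c ^ n) k ⟨
    c ^ suc n * k              ∎
    where open ≡-Reasoning

  *-distribˡ-∑ᶜ : ∀ n k (F : Colouring n → ℕ) → k * ∑ᶜ n F ≡ ∑ᶜ n (λ h → k * F h)
  *-distribˡ-∑ᶜ zero    k F = refl
  *-distribˡ-∑ᶜ (suc n) k F = trans (*-distribˡ-sum k (λ a → ∑ᶜ n (λ h → F (a ∷ h))))
                                    (sum-cong-≗ {c} (λ a → *-distribˡ-∑ᶜ n k (λ h → F (a ∷ h))))

  ∑ᶜ-comm : ∀ n {m} (F : Colouring n → Fin m → ℕ) →
            ∑ᶜ n (λ h → ∑[ i < m ] F h i) ≡ ∑[ i < m ] ∑ᶜ n (λ h → F h i)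
  ∑ᶜ-comm zero    F = refl
  ∑ᶜ-comm (suc n) F = trans (sum-cong-≗ {c} (λ a → ∑ᶜ-comm n (λ h → F (a ∷ h))))
                            (∑-comm (λ a i → ∑ᶜ n (λ h → F (a ∷ h) i)))

  ∑ᶜ-pigeonhole : ∀ .{{_ : NonZero c}} n (F G : Colouring n → ℕ) → ∑ᶜ n F ≤ ∑ᶜ n G →
                  Σ (Colouring n) λ h → F h ≤ G h
  ∑ᶜ-pigeonhole zero    F G F≤G = (λ ()) , F≤G
  ∑ᶜ-pigeonhole (suc n) F G ∑F≤∑G with ∑-pigeonhole (λ a → ∑ᶜ n (λ h → F (a ∷ h))) (λ a → ∑ᶜ n (λ h → G (a ∷ h))) ∑F≤∑G
  ... | a , ∑Fₐ≤∑Gₐ with ∑ᶜ-pigeonhole n (λ h → F (a ∷ h)) (λ h → G (a ∷ h)) ∑Fₐ≤∑Gₐ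
  ...   | h , F≤G = a ∷ h , F≤G

  ∑ᶜ-marginal : ∀ n (x : Fin n) (G : Fin c → ℕ) → c * ∑ᶜ n (λ h → G (h x)) ≡ c ^ n * ∑[ a < c ] G a
  ∑ᶜ-marginal (suc n) zero    G = begin
    c * ∑[ a < c ] ∑ᶜ n (λ _ → G a)  ≡⟨ cong (c *_) (sum-cong-≗ {c} (λ a → ∑ᶜ-const n (G a))) ⟩
    c * ∑[ a < c ] (c ^ n * G a)     ≡⟨ cong (c *_) (*-distribˡ-sum (c ^ n) G) ⟨
    c * (c ^ n * ∑[ a < c ] G a)     ≡⟨ *-assoc c (c ^ n) _ ⟨
    c ^ suc n * ∑[ a < c ] G a       ∎
    where open ≡-Reasoning
  ∑ᶜ-marginal (suc n) (suc x) G = begin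
    c * ∑[ a < c ] ∑ᶜ n (λ h → G (h x))  ≡⟨ cong (c *_) (∑-const c _) ⟩
    c * (c * ∑ᶜ n (λ h → G (h x)))       ≡⟨ cong (c *_) (∑ᶜ-marginal n x G) ⟩
    c * (c ^ n * ∑[ a < c ] G a)         ≡⟨ *-assoc c (c ^ n) _ ⟨
    c ^ suc n * ∑[ a < c ] G a           ∎
    where open ≡-Reasoning

  ∑ᶜ-pinned : ∀ n (y : Fin n) (G : Fin c → Fin c → ℕ) → (∀ a → ∑[ b < c ] G a b ≡ 1) →
              c * ∑ᶜ (suc n) (λ h → G (h zero) (h (suc y))) ≡ c ^ suc n
  ∑ᶜ-pinned n y G ∑G≡1 = begin
    c * ∑[ a < c ] ∑ᶜ n (λ h → G a (h y))    ≡⟨ *-distribˡ-sum c (λ a → ∑ᶜ n (λ h → G a (h y))) ⟩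
    ∑[ a < c ] (c * ∑ᶜ n (λ h → G a (h y)))  ≡⟨ sum-cong-≗ {c} (λ a → ∑ᶜ-marginal n y (G a)) ⟩
    ∑[ a < c ] (c ^ n * ∑[ b < c ] G a b)    ≡⟨ sum-cong-≗ {c} (λ a → cong (c ^ n *_) (∑G≡1 a)) ⟩
    ∑[ a < c ] (c ^ n * 1)                   ≡⟨ ∑-const c _ ⟩
    c * (c ^ n * 1)                          ≡⟨ cong (c *_) (*-identityʳ _) ⟩
    c ^ suc n                                ∎
    where open ≡-Reasoning

  ∑ᶜ-collisions : ∀ n (x y : Fin n) → x ≢ y → c * ∑ᶜ n (λ h → ⟦ does (h x ≟ h y) ⟧) ≡ c ^ n
  ∑ᶜ-collisions (suc n) zero    zero    x≢y = ⊥-elim (x≢y refl)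
  ∑ᶜ-collisions (suc n) zero    (suc y) _   = ∑ᶜ-pinned n y (λ a b → ⟦ does (a ≟ b) ⟧) ∑-⟦a≟⟧
  ∑ᶜ-collisions (suc n) (suc x) zero    _   = ∑ᶜ-pinned n x (λ a b → ⟦ does (b ≟ a) ⟧) ∑-⟦≟a⟧
  ∑ᶜ-collisions (suc n) (suc x) (suc y) x≢y = begin
    c * ∑[ a < c ] ∑ᶜ n (λ h → ⟦ does (h x ≟ h y) ⟧)  ≡⟨ cong (c *_) (∑-const c _) ⟩
    c * (c * ∑ᶜ n (λ h → ⟦ does (h x ≟ h y) ⟧))       ≡⟨ cong (c *_) (∑ᶜ-collisions n x y (x≢y ∘ cong suc)) ⟩
    c ^ suc n                                         ∎
    where open ≡-Reasoning

  ∑ᶜ-∑-≤ : ∀ n {m} (F : Colouring n → Fin m → ℕ) (g : Fin m → ℕ) →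
           (∀ i → c * ∑ᶜ n (λ h → F h i) ≤ c ^ n * g i) →
           c * ∑ᶜ n (λ h → ∑[ i < m ] F h i) ≤ c ^ n * ∑[ i < m ] g i
  ∑ᶜ-∑-≤ n {m} F g bound = begin
    c * ∑ᶜ n (λ h → ∑[ i < m ] F h i)    ≡⟨ cong (c *_) (∑ᶜ-comm n F) ⟩
    c * ∑[ i < m ] ∑ᶜ n (λ h → F h i)    ≡⟨ *-distribˡ-sum c (λ i → ∑ᶜ n (λ h → F h i)) ⟩
    ∑[ i < m ] (c * ∑ᶜ n (λ h → F h i))  ≤⟨ ∑-mono-≤ bound ⟩
    ∑[ i < m ] (c ^ n * g i)             ≡⟨ *-distribˡ-sum (c ^ n) g ⟨
    c ^ n * ∑[ i < m ] g i               ∎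
    where open ≤-Reasoning

  ∑ᶜ-zero : ∀ n → c * ∑ᶜ n (λ _ → 0) ≡ 0
  ∑ᶜ-zero n = trans (cong (c *_) (trans (∑ᶜ-const n 0) (*-zeroʳ (c ^ n)))) (*-zeroʳ c)

-- A statement c * ∑ᶜ n F ≤ c ^ n * x says that F averages at most x / c over all colourings.
module RectangleCover {n m} (M : Matrix n m) (d c : ℕ) .{{_ : NonZero c}} (2d<c : 2 * d < c)
                      (zeros≤d : ∀ j → zerosInColumn M j ≤ d) where

  open ColouringSum c

  clash : Colouring n → Fin c → Fin m → Bool
  clash h a j = anyFin n (λ i → not (M i j) ∧ does (h i ≟ a))

  clash-self : ∀ h i j → M i j ≡ false → T (clash h (h i) j)
  clash-self h i j Mᵢⱼ≡false =
    anyFin-intro _ i (from T-∧ (from T-not-≡ Mᵢⱼ≡false , from T-≡ (dec-true (h i ≟ h i) refl)))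

  clash-free⇒M : ∀ h i j → T (not (clash h (h i) j)) → T (M i j)
  clash-free⇒M h i j free with M i j in Mᵢⱼ
  ... | true  = _
  ... | false = ⊥-elim (subst (T ∘ not) (to T-≡ (clash-self h i j Mᵢⱼ)) free)

  expectedCollisionsWithZero : ∀ i j → T (M i j) → ∀ i′ →
    c * ∑ᶜ n (λ h → ⟦ not (M i′ j) ∧ does (h i′ ≟ h i) ⟧) ≡ c ^ n * ⟦ not (M i′ j) ⟧
  expectedCollisionsWithZero i j Mᵢⱼ i′ with M i′ j in Mᵢ′ⱼ
  ... | true  = trans (∑ᶜ-zero n) (sym (*-zeroʳ (c ^ n)))
  ... | false = trans (∑ᶜ-collisions n i′ i i′≢i) (sym (*-identityʳ (c ^ n)))
    where
    i′≢i : i′ ≢ i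
    i′≢i refl = subst T Mᵢ′ⱼ Mᵢⱼ

  expectedClash : ∀ i j → T (M i j) → c * ∑ᶜ n (λ h → ⟦ clash h (h i) j ⟧) ≤ c ^ n * d
  expectedClash i j Mᵢⱼ = begin
    c * ∑ᶜ n (λ h → ⟦ clash h (h i) j ⟧)
      ≤⟨ *-monoʳ-≤ c (∑ᶜ-mono-≤ n (λ h → ⟦anyFin⟧≤∑ (λ i′ → not (M i′ j) ∧ does (h i′ ≟ h i)))) ⟩
    c * ∑ᶜ n (λ h → ∑[ i′ < n ] ⟦ not (M i′ j) ∧ does (h i′ ≟ h i) ⟧)
      ≤⟨ ∑ᶜ-∑-≤ n _ _ (λ i′ → ≤-reflexive (expectedCollisionsWithZero i j Mᵢⱼ i′)) ⟩
    c ^ n * ∑[ i′ < n ] ⟦ not (M i′ j) ⟧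
      ≡⟨ cong (c ^ n *_) (countZeros≡∑ n (λ i′ → M i′ j)) ⟨
    c ^ n * zerosInColumn M j
      ≤⟨ *-monoʳ-≤ (c ^ n) (zeros≤d j) ⟩
    c ^ n * d ∎
    where open ≤-Reasoning

  uncovered : Matrix n m → Colouring n → Matrix n m
  uncovered W h i j = W i j ∧ clash h (h i) j

  expectedUncoveredEntry : ∀ W → W ⊆ M → ∀ i j →
    c * ∑ᶜ n (λ h → ⟦ uncovered W h i j ⟧) ≤ c ^ n * (d * ⟦ W i j ⟧)
  expectedUncoveredEntry W W⊆M i j with W i j | W⊆M i j
  ... | false | _    = ≤-reflexive (trans (∑ᶜ-zero n) (sym (trans (cong (c ^ n *_) (*-zeroʳ d)) (*-zeroʳ (c ^ n)))))
  ... | true  | W⇒M = ≤-trans (expectedClash i j (W⇒M _)) (≤-reflexive (cong (c ^ n *_) (sym (*-identityʳ d))))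

  expectedUncovered : ∀ W → W ⊆ M → c * ∑ᶜ n (λ h → ones (uncovered W h)) ≤ c ^ n * (d * ones W)
  expectedUncovered W W⊆M = begin
    c * ∑ᶜ n (λ h → ones (uncovered W h))
      ≤⟨ ∑ᶜ-∑-≤ n _ _ (λ i → ≤-trans (∑ᶜ-∑-≤ n _ _ (expectedUncoveredEntry W W⊆M i))
                                      (≤-reflexive (cong (c ^ n *_) (sym (*-distribˡ-sum d (λ j → ⟦ W i j ⟧)))))) ⟩
    c ^ n * ∑[ i < n ] (d * ∑[ j < m ] ⟦ W i j ⟧)
      ≡⟨ cong (c ^ n *_) (*-distribˡ-sum d (λ i → ∑[ j < m ] ⟦ W i j ⟧)) ⟨
    c ^ n * (d * ones W) ∎
    where open ≤-Reasoning

  goodColouring : ∀ W → W ⊆ M → Σ (Colouring n) λ h → c * ones (uncovered W h) ≤ d * ones W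
  goodColouring W W⊆M = ∑ᶜ-pigeonhole n (λ h → c * ones (uncovered W h)) (λ _ → d * ones W) (begin
    ∑ᶜ n (λ h → c * ones (uncovered W h))  ≡⟨ *-distribˡ-∑ᶜ n c (λ h → ones (uncovered W h)) ⟨
    c * ∑ᶜ n (λ h → ones (uncovered W h))  ≤⟨ expectedUncovered W W⊆M ⟩
    c ^ n * (d * ones W)                   ≡⟨ ∑ᶜ-const n (d * ones W) ⟨
    ∑ᶜ n (λ _ → d * ones W)                ∎)
    where open ≤-Reasoning

  halving : ∀ {u w} k → c * u ≤ d * w → w < 2 ^ suc k → u < 2 ^ k
  halving {u} {w} k cu≤dw w<2^[1+k] = *-cancelˡ-< 2 _ _ (≤-<-trans 2u≤w w<2^[1+k])
    where
    open ≤-Reasoning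
    2u≤w : 2 * u ≤ w
    2u≤w = *-cancelˡ-≤ c (begin
      c * (2 * u)  ≡⟨ *-comm c (2 * u) ⟩
      2 * u * c    ≡⟨ *-assoc 2 u c ⟩
      2 * (u * c)  ≡⟨ cong (2 *_) (*-comm u c) ⟩
      2 * (c * u)  ≤⟨ *-monoʳ-≤ 2 cu≤dw ⟩
      2 * (d * w)  ≡⟨ *-assoc 2 d w ⟨
      2 * d * w    ≤⟨ *-monoˡ-≤ w (<⇒≤ 2d<c) ⟩
      c * w        ∎)

  avoid : Colouring n → Matrix c m
  avoid h a j = not (clash h a j)

  cover : ∀ k (W : Matrix n m) → W ⊆ M → ones W < 2 ^ k →
          Σ (Matrix n (k * c)) λ A → Σ (Matrix (k * c) m) λ B → W ⊆ (A ⊙ B) × (A ⊙ B) ⊆ M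
  cover zero    W W⊆M ones<1 =
    (λ _ ()) , (λ ()) , (λ i j Wᵢⱼ → ⊥-elim (<⇒≱ ones<1 (ones-pos W i j Wᵢⱼ))) , (λ _ _ ())
  cover (suc k) W W⊆M ones<2^[1+k] with goodColouring W W⊆M
  ... | h , few with cover k (uncovered W h) (λ i j → W⊆M i j ∘ proj₁ ∘ to T-∧) (halving k few ones<2^[1+k])
  ...   | A , B , U⊆AB , AB⊆M = (λ i → indicator h i ++ A i) , avoid h ++ B , W⊆ , ⊆M
    where
    entry : ∀ i j → ((λ i → indicator h i ++ A i) ⊙ (avoid h ++ B)) i j ≡ avoid h (h i) j ∨ (A ⊙ B) i j
    entry i j = trans (⊙-++ (indicator h) A (avoid h) B i j) (cong (_∨ (A ⊙ B) i j) (⊙-indicator h (avoid h) i j))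
    W⊆ : W ⊆ ((λ i → indicator h i ++ A i) ⊙ (avoid h ++ B))
    W⊆ i j Wᵢⱼ = subst T (sym (entry i j)) (from T-∨ (map₂ (U⊆AB i j) (T-split (W i j) (clash h (h i) j) Wᵢⱼ)))
    ⊆M : ((λ i → indicator h i ++ A i) ⊙ (avoid h ++ B)) ⊆ M
    ⊆M i j covered = [ clash-free⇒M h i j , AB⊆M i j ]′ (to T-∨ (subst T (entry i j) covered))


factorization-fewZerosPerColumn : ∀ {n m} (M : Matrix n m) d k → (∀ j → zerosInColumn M j ≤ d) → n * m < 2 ^ k →
                                  BoolFactorization M (k * suc (2 * d))
factorization-fewZerosPerColumn M d k zeros≤d size<2^k =
  let A , B , M⊆AB , AB⊆M = cover k M (λ _ _ → id) (≤-<-trans (ones≤size M) size<2^k)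
  in  A , B , λ i j → T-ext (M⊆AB i j) (AB⊆M i j)
  where open RectangleCover M d (suc (2 * d)) ≤-refl zeros≤d

RankWithinCBound : ℕ → ∀ {n} → Matrix n n → Set
RankWithinCBound d {n} M = Σ ℕ λ r → BoolFactorization M r × LeCBound d n r

viaTrivialFactorization : ∀ d {n} (M : Matrix n n) N → n ≤3·e·ln[ n , N ] → RankWithinCBound d M
viaTrivialFactorization d {n} M N n≤3eL = n , factorization-trivial M , leCBound-intro d n n N n≤[d+1]n n≤3eL
  where
  n≤[d+1]n : n ≤ (d + 1) * n
  n≤[d+1]n = subst (λ δ → n ≤ δ * n) (+-comm 1 d) (m≤m+n n (d * n))

viaRectangleCover : ∀ d {n} (M : Matrix n n) → (∀ j → zerosInColumn M j ≤ d) → ∀ k N →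
                    n * n < 2 ^ k → 2 * k ≤3·e·ln[ n , N ] → RankWithinCBound d M
viaRectangleCover d {n} M zeros≤d k N n²<2^k 2k≤3eL =
  k * suc (2 * d) , factorization-fewZerosPerColumn M d k zeros≤d n²<2^k ,
  leCBound-intro d n (2 * k) N k[2d+1]≤[d+1]2k 2k≤3eL
  where
  identity : ∀ k d → k * suc (2 * d) + k ≡ (d + 1) * (2 * k)
  identity = solve-∀
  k[2d+1]≤[d+1]2k : k * suc (2 * d) ≤ (d + 1) * (2 * k)
  k[2d+1]≤[d+1]2k = subst (k * suc (2 * d) ≤_) (identity k d) (m≤m+n _ k)

rankWithinCBound-<32 : ∀ d {n} (M : Matrix n n) → (∀ j → zerosInColumn M j ≤ d) → 2 ≤ n → n < 32 →
                       RankWithinCBound d M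
rankWithinCBound-<32 d {n} M zeros≤d 2≤n n<32 =
  [ viaTrivialFactorization d M 3 , viaRectangleCover d M zeros≤d 10 3 n²<2^10 ]′ (small≤3·e·ln n<32 2≤n)
  where
  n≤31 : n ≤ 31
  n≤31 = ≤-pred n<32
  n²<2^10 : n * n < 2 ^ 10
  n²<2^10 = ≤-<-trans (*-mono-≤ n≤31 n≤31) (<ᵇ⇒< 961 1024 _)

binaryMagnitude : ∀ n → 1 ≤ n → Σ ℕ λ a → 2 ^ a ≤ n × n < 2 ^ suc a
binaryMagnitude (suc zero)    _ = 0 , ≤-refl , s≤s (s≤s z≤n)
binaryMagnitude (suc (suc n)) _ with binaryMagnitude (suc n) (s≤s z≤n)
... | a , 2^a≤1+n , 1+n<2^[1+a] with suc (suc n) <? 2 ^ suc a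
...   | yes 2+n<2^[1+a] = a , m≤n⇒m≤1+n 2^a≤1+n , 2+n<2^[1+a]
...   | no  2+n≮2^[1+a] = suc a , ≮⇒≥ 2+n≮2^[1+a] ,
                          ≤-<-trans 1+n<2^[1+a] (^-monoʳ-< 2 (s≤s (s≤s z≤n)) {suc a} {suc (suc a)} ≤-refl)

viaMagnitude : ∀ d {n} (M : Matrix (suc n) (suc n)) → (∀ j → zerosInColumn M j ≤ d) → ∀ b →
               2 ^ (5 + b) ≤ suc n → suc n < 2 ^ (6 + b) → RankWithinCBound d M
viaMagnitude d {n} M zeros≤d b lower upper =
  viaRectangleCover d M zeros≤d k (2 ^ (3 + b)) n²<2^k
    (subst (_≤3·e·ln[ suc n , 2 ^ (3 + b) ]) (4[6+b]≡2k b) (4[6+b]≤3·e·ln b n lower))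
  where
  k = (6 + b) + (6 + b)
  n²<2^k : suc n * suc n < 2 ^ k
  n²<2^k = subst (suc n * suc n <_) (sym (^-distribˡ-+-* 2 (6 + b) (6 + b))) (*-mono-< upper upper)
  4[6+b]≡2k : ∀ b → 4 * (6 + b) ≡ 2 * ((6 + b) + (6 + b))
  4[6+b]≡2k = solve-∀

rankWithinCBound-≥32 : ∀ d {n} (M : Matrix n n) → (∀ j → zerosInColumn M j ≤ d) → 32 ≤ n → RankWithinCBound d M
rankWithinCBound-≥32 d {suc n} M zeros≤d 32≤n with binaryMagnitude (suc n) (s≤s z≤n)
... | a , 2^a≤n , n<2^[1+a] = viaMagnitude d M zeros≤d (a ∸ 5) lower upper
  where
  5≤a : 5 ≤ a
  5≤a = ≮⇒≥ (λ a<5 → <⇒≱ (<-≤-trans n<2^[1+a] (^-monoʳ-≤ 2 {suc a} {5} a<5)) 32≤n)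
  a≡5+b : a ≡ 5 + (a ∸ 5)
  a≡5+b = sym (m+[n∸m]≡n 5≤a)
  lower : 2 ^ (5 + (a ∸ 5)) ≤ suc n
  lower = subst (λ e → 2 ^ e ≤ suc n) a≡5+b 2^a≤n
  upper : suc n < 2 ^ (6 + (a ∸ 5))
  upper = subst (λ e → suc n < 2 ^ suc e) a≡5+b n<2^[1+a]

mainTheorem4 : (n d : ℕ) → 2 ≤ n → (M : Matrix n n) →
    (∀ j → zerosInColumn M j ≤ d) →
    Σ ℕ λ r → BoolFactorization M r × LeCBound d n r
mainTheorem4 n d 2≤n M zeros≤d with n <? 32
... | yes n<32 = rankWithinCBound-<32 d M zeros≤d 2≤n n<32
... | no  n≮32 = rankWithinCBound-≥32 d M zeros≤d (≮⇒≥ n≮32)
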